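{- Let $G=(V,E)$ be a directed graph and $S\subseteq V$. Then $S$ power dominates $G$ if and only if there is a valid coloring of $G$ whose set of origins is exactly $S$.
   Context: $G$ has no loops or parallel edges but may have antiparallel pairs of edges $(u,v),(v,u)$. For $S\subseteq V$, $\mathcal{P}_S$ is obtained by: (D1) if $v\in S$ then $v$ and all its out-neighbors are in $\mathcal{P}_S$; (D2) repeatedly, if $v\in\mathcal{P}_S$ and exactly one out-neighbor $w$ of $v$ is not in $\mathcal{P}_S$, insert $w$. $S$ power dominates $G$ if $\mathcal{P}_S=V$. A coloring of $G$ is a partition $E=E_r\cup E_b$ of the edges into red and blue edges; let $G_r=(V,E_r)$. It is valid if: (1) no two antiparallel edges are both red; (2) for every $v$, $d^-_{G_r}(v)\le1$, and $d^-_{G_r}(v)=1$ implies $d^+_{G_r}(v)\le1$; (3) $G$ has no dependency cycle, where a dependency cycle is a sequence of directed edges whose underlying undirected graph forms a cycle such that, traversing the cycle, all red edges are oriented in one direction, all blue edges are oriented in the opposite direction, and no two consecutive edges are blue. A node is an origin of the coloring if it has no incoming edge in $G_r$. -}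

module Defs where

open import Data.Nat using (ℕ; zero; suc)
open import Data.Fin using (Fin; zero; suc)
open import Data.Fin.Subset using (Subset; _∈_)
open import Data.Bool using (Bool; true; false; if_then_else_)
open import Data.Product using (Σ; ∃; ∃-syntax; _×_; _,_)
open import Relation.Binary.PropositionalEquality using (_≡_; _≢_)
open import Relation.Nullary using (¬_)
open import Function.Bundles using (_⇔_)

-- A finite directed graph on vertex set Fin n, given by its adjacency
-- relation (so no parallel edges); no loops. Antiparallel pairs allowed.
record Digraph : Set where
  field
    n      : ℕ
    adj    : Fin n → Fin n → Bool
    noLoop : ∀ v → adj v v ≡ false

open Digraph public

Edge : (G : Digraph) → Fin (n G) → Fin (n G) → Set
Edge G u v = adj G u v ≡ true

-- Power domination.  P_S is the least set closed under (D1),(D2);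
-- this is exactly the result of the (monotone) propagation process.

data InP (G : Digraph) (S : Subset (n G)) : Fin (n G) → Set where
  d1-self : ∀ {v} → v ∈ S → InP G S v
  d1-nbr  : ∀ {v w} → v ∈ S → Edge G v w → InP G S w
  d2      : ∀ {v w} → InP G S v → Edge G v w →
            (∀ u → Edge G v u → u ≢ w → InP G S u) → InP G S w

PowerDominates : (G : Digraph) → Subset (n G) → Set
PowerDominates G S = ∀ v → InP G S v

-- Colorings: col u v ≡ true means the edge (u,v) is red, false blue
-- (the value on non-edges is irrelevant).

Coloring : Digraph → Set
Coloring G = Fin (n G) → Fin (n G) → Bool

Red : (G : Digraph) → Coloring G → Fin (n G) → Fin (n G) → Set
Red G col u v = Edge G u v × col u v ≡ true

cnext : ∀ {m} → Fin (suc m) → Fin (suc m)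
cnext {zero}  zero    = zero
cnext {suc m} zero    = suc zero
cnext {suc m} (suc i) with cnext {m} i
... | zero  = zero
... | suc j = suc (suc j)

-- A dependency cycle: a cyclic sequence of pairwise distinct vertices
-- vs 0, …, vs (k+1) (length ≥ 2); step i goes from vs i to vs (i+1 mod),
-- using the edge (vs i, vs (i+1)) if dir i ≡ true (traversed forwards)
-- or the edge (vs (i+1), vs i) if dir i ≡ false (traversed backwards).
-- endpoints of the edge used in step i of a cyclic vertex sequence
stepSrc stepTgt : ∀ {N m} → (Fin (suc m) → Fin N) → (Fin (suc m) → Bool) →
                  Fin (suc m) → Fin N
stepSrc vs dir i = if dir i then vs i else vs (cnext i)
stepTgt vs dir i = if dir i then vs (cnext i) else vs i

record DependencyCycle (G : Digraph) (col : Coloring G) : Set where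
  field
    k     : ℕ
    vs    : Fin (suc (suc k)) → Fin (n G)
    dir   : Fin (suc (suc k)) → Bool
  src = stepSrc vs dir
  tgt = stepTgt vs dir
  field
    vs-injective : ∀ i j → vs i ≡ vs j → i ≡ j
    isEdge       : ∀ i → Edge G (src i) (tgt i)
    edges-distinct : ∀ i j → i ≢ j → ¬ (src i ≡ src j × tgt i ≡ tgt j)
    δ            : Bool
    red-dir      : ∀ i → col (src i) (tgt i) ≡ true  → dir i ≡ δ
    blue-dir     : ∀ i → col (src i) (tgt i) ≡ false → dir i ≢ δ
    no-two-blue  : ∀ i → ¬ (col (src i) (tgt i) ≡ false ×
                            col (src (cnext i)) (tgt (cnext i)) ≡ false)

record Valid (G : Digraph) (col : Coloring G) : Set where
  field
    noRedAntiparallel : ∀ u v → ¬ (Red G col u v × Red G col v u)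
    -- (2) red in-degree ≤ 1, and red in-degree 1 ⇒ red out-degree ≤ 1
    inDeg≤1  : ∀ u u' v → Red G col u v → Red G col u' v → u ≡ u'
    outDeg≤1 : ∀ u v w w' → Red G col u v → Red G col v w → Red G col v w' → w ≡ w'
    noDepCycle : ¬ DependencyCycle G col

Origin : (G : Digraph) → Coloring G → Fin (n G) → Set
Origin G col v = ¬ (∃[ u ] Red G col u v)

ValidColoringWithOrigins : (G : Digraph) → Subset (n G) → Set
ValidColoringWithOrigins G S =
  Σ (Coloring G) λ col → Valid G col × (∀ v → (v ∈ S) ⇔ Origin G col v)

-- If S power dominates G, run the propagation in rounds and color red the edge into each
-- w ∉ S from the reason w was observed: its least-index in-neighbour in S, or the vertex
-- that forced it.  The potential Ψ (0 on S, 1 + index of the parent on N(S) ∖ S, n + round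
-- beyond) increases along red edges and drops from a red edge to any blue edge with the same
-- source, so along a dependency cycle 2 Ψ(target) (+ 1 for blue) is strictly monotone, which
-- is impossible on a cycle.
--
-- Conversely, given a valid coloring, suppose v ∉ P_S.  Walk backwards along red edges
-- (every non-origin has a red in-edge) while outside P_S; at a vertex of P_S whose red
-- out-edge leaves P_S, the failure of (D2) yields a blue out-edge leaving P_S.  The walk never
-- takes two blue steps in a row, so its first cycle is a dependency cycle.

module Submission where

open import Defs
open import Data.Bool using (Bool; true; false; not)
import Data.Bool as Bool
open import Data.Bool.Properties using (¬-not; not-injective)
open import Data.Fin using (Fin; zero; suc; toℕ)
import Data.Fin as Fin
open import Data.Fin.Properties
  using (_≟_; any?; all?; ¬∀⟶∃¬; pigeonhole; toℕ<n; toℕ-injective)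
open import Data.Fin.Subset using (Subset; _∈_; _∉_)
open import Data.Fin.Subset.Properties using (_∈?_)
open import Data.List using (allFin)
import Data.List.Relation.Unary.All as All
open import Data.List.Membership.Propositional.Properties using (∈-allFin)
open import Data.List.Extrema.Nat using (argmax; argmin; f[xs]≤f[argmax]; f[argmin]≤f[xs])
open import Data.Nat
  using (ℕ; zero; suc; _+_; _∸_; _≤_; _<_; z≤n; s≤s; s≤s⁻¹; _≤′_; ≤′-refl; ≤′-step)
import Data.Nat as ℕ
open import Data.Nat.GeneralisedArithmetic using (fold)
open import Data.Nat.Induction using (<-rec)
open import Data.Nat.Properties
  using ( anyUpTo?; ≤⇒≤′; ≮⇒≥; <⇒≱; <⇒≯; <-asym; <-cmp; ≤-refl; ≤-reflexive; ≤-trans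
        ; ≤-<-trans; ≤∧≢⇒<; n<1+n; m≤n⇒m≤1+n; m≤m+n; m∸n+n≡m; +-suc; +-cancelʳ-≡
        ; +-mono-<; +-mono-≤; +-monoˡ-≤; +-monoʳ-< )
open import Data.Product using (Σ; ∃; ∃₂; ∃-syntax; _×_; _,_; proj₁; proj₂)
import Data.Product as Σ
open import Data.Sum using (_⊎_; inj₁; inj₂; [_,_])
open import Function using (id; _∘_)
open import Function.Bundles using (_⇔_; mk⇔; Equivalence)
open import Level using (Level; 0ℓ)
open import Relation.Binary.Definitions using (tri<; tri≈; tri>)
open import Relation.Binary.PropositionalEquality
  using (_≡_; _≢_; refl; sym; trans; cong; cong₂; subst; subst₂; module ≡-Reasoning)
open import Relation.Nullary using (¬_; Dec; yes; no; does; contradiction)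
open import Relation.Nullary.Decidable
  using (_→-dec_; _×-dec_; _⊎-dec_; ¬?; map′; decidable-stable; dec-true; dec-false)
open import Relation.Unary using (Pred; Decidable; _⊆_)

private variable ℓ : Level

Least : Pred ℕ ℓ → Set ℓ
Least P = ∃[ m ] (P m × ∀ {j} → P j → m ≤ j)

least : {P : Pred ℕ ℓ} → Decidable P → ∀ n → P n → Least P
least {P = P} P? = <-rec (λ n → P n → Least P) search
  where
    search : ∀ n → (∀ {m} → m < n → P m → Least P) → P n → Least P
    search n smaller pn with anyUpTo? P? n
    ... | yes (m , m<n , pm) = smaller m<n pm
    ... | no none            = n , pn , λ pj → ≮⇒≥ (λ j<n → none (_ , j<n , pj))

least-Fin : ∀ {m} {P : Pred (Fin m) ℓ} → Decidable P → ∃ P →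
            ∃[ i ] (P i × ∀ {j} → P j → i Fin.≤ j)
least-Fin P? (i , pi) with least (λ k → any? (λ j → (toℕ j ℕ.≟ k) ×-dec P? j)) (toℕ i) (i , refl , pi)
... | _ , (j , refl , pj) , minimal = j , pj , λ {j′} pj′ → minimal (j′ , refl , pj′)

choose : ∀ {m} {P : Pred (Fin m) ℓ} → Decidable P → Fin m → Fin m
choose P? default with any? P?
... | yes (i , _) = i
... | no _        = default

choose-∈ : ∀ {m} {P : Pred (Fin m) ℓ} (P? : Decidable P) default → ∃ P → P (choose P? default)
choose-∈ P? _ witness with any? P?
... | yes (_ , p) = p
... | no none     = contradiction witness none

does-true⇒ : ∀ {A : Set ℓ} (a? : Dec A) → does a? ≡ true → A
does-true⇒ (yes a) _ = a

does-false⇒¬ : ∀ {A : Set ℓ} (a? : Dec A) → does a? ≡ false → ¬ A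
does-false⇒¬ (no ¬a) _ = ¬a

cnext-toℕ : ∀ {m} (i : Fin (suc m)) →
            toℕ (cnext i) ≡ suc (toℕ i) ⊎ (toℕ i ≡ m × cnext i ≡ zero)
cnext-toℕ {zero}  zero    = inj₂ (refl , refl)
cnext-toℕ {suc m} zero    = inj₁ refl
cnext-toℕ {suc m} (suc i) with cnext {m} i | cnext-toℕ {m} i
... | zero  | inj₂ (i≡m , _) = inj₂ (cong suc i≡m , refl)
... | suc _ | inj₁ eq        = inj₁ (cong suc eq)

no-ascending-cycle : ∀ {m} (θ : Fin (suc m) → ℕ) → ¬ (∀ i → θ i < θ (cnext i))
no-ascending-cycle θ ascending =
  <⇒≱ (ascending top) (All.lookup (f[xs]≤f[argmax] {f = θ} zero (allFin _)) (∈-allFin (cnext top)))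
  where top = argmax θ zero (allFin _)

no-descending-cycle : ∀ {m} (θ : Fin (suc m) → ℕ) → ¬ (∀ i → θ (cnext i) < θ i)
no-descending-cycle θ descending =
  <⇒≱ (descending bottom) (All.lookup (f[argmin]≤f[xs] {f = θ} zero (allFin _)) (∈-allFin (cnext bottom)))
  where bottom = argmin θ zero (allFin _)

module _ {N : ℕ} (L : ℕ → Pred (Fin N) ℓ) (L? : ∀ k → Decidable (L k))
         (grows : ∀ {k} → L k ⊆ L (suc k))
         (settles : ∀ {k} → L (suc k) ⊆ L k → L (suc (suc k)) ⊆ L (suc k)) where

  grows-≤′ : ∀ {j k} → j ≤′ k → L j ⊆ L k
  grows-≤′ ≤′-refl       = id
  grows-≤′ (≤′-step j≤k) = grows ∘ grows-≤′ j≤k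

  settled-≤′ : ∀ {j k} → L (suc j) ⊆ L j → j ≤′ k → L (suc k) ⊆ L k
  settled-≤′ settled ≤′-refl       = settled
  settled-≤′ settled (≤′-step j≤k) = settles (settled-≤′ settled j≤k)

  kept? : ∀ k w → Dec (L (suc k) w → L k w)
  kept? k w = L? (suc k) w →-dec L? k w

  -- Otherwise each of the rounds 0, …, N adds a fresh element, N + 1 in all.
  chain-stabilises : L (suc N) ⊆ L N
  chain-stabilises with any? (all? ∘ kept? ∘ toℕ)
  ... | yes (k , settled) = settled-≤′ (λ {w} → settled w) (≤⇒≤′ (s≤s⁻¹ (toℕ<n k)))
  ... | no never = contradiction (pigeonhole (n<1+n N) (proj₁ ∘ fresh)) collision-free
    where
      fresh : ∀ k → ∃[ w ] ¬ (L (suc (toℕ k)) w → L (toℕ k) w)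
      fresh k = ¬∀⟶∃¬ N _ (kept? (toℕ k)) (λ settled → never (k , settled))

      fresh-new : ∀ k → L (suc (toℕ k)) (proj₁ (fresh k))
      fresh-new k = decidable-stable (L? _ _) (λ ∉L → proj₂ (fresh k) (λ ∈L → contradiction ∈L ∉L))

      fresh-∉ : ∀ k → ¬ L (toℕ k) (proj₁ (fresh k))
      fresh-∉ k ∈L = proj₂ (fresh k) (λ _ → ∈L)

      collision-free : ¬ ∃₂ λ i j → i Fin.< j × proj₁ (fresh i) ≡ proj₁ (fresh j)
      collision-free (i , j , i<j , same) =
        fresh-∉ j (subst (L (toℕ j)) same (grows-≤′ (≤⇒≤′ i<j) (fresh-new i)))

record Cycle {N : ℕ} (f : Fin N → Fin N) (P : Pred (Fin N) ℓ) : Set ℓ where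
  field
    len          : ℕ
    vs           : Fin (suc len) → Fin N
    vs-injective : ∀ i j → vs i ≡ vs j → i ≡ j
    vs-cnext     : ∀ i → vs (cnext i) ≡ f (vs i)
    vs-∈         : ∀ i → P (vs i)

module _ {N} (f : Fin N → Fin N) {P : Pred (Fin N) ℓ} (f-pres : ∀ {x} → P x → P (f x))
         {z} (pz : P z) where

  private
    orbit : ℕ → Fin N
    orbit = fold z f

    orbit-∈ : ∀ t → P (orbit t)
    orbit-∈ zero    = pz
    orbit-∈ (suc t) = f-pres (orbit-∈ t)

    segment-cycle : ∀ {i j} → i < j → orbit i ≡ orbit j →
                    (∀ {a b} → a < b → b < j → orbit a ≢ orbit b) → Cycle f P
    segment-cycle {i} {j} i<j closes distinct = record
      { len = len ; vs = vs ; vs-injective = vs-injective ; vs-cnext = vs-cnext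
      ; vs-∈ = λ t → orbit-∈ (toℕ t + i) }
      where
        len : ℕ
        len = j ∸ suc i

        len+1+i≡j : len + suc i ≡ j
        len+1+i≡j = m∸n+n≡m i<j

        vs : Fin (suc len) → Fin N
        vs t = orbit (toℕ t + i)

        t+i<j : ∀ t → toℕ t + i < j
        t+i<j t = subst (toℕ t + i <_) (trans (sym (+-suc len i)) len+1+i≡j)
                        (s≤s (+-monoˡ-≤ i (s≤s⁻¹ (toℕ<n t))))

        orbit-injective : ∀ {a b} → a < j → b < j → orbit a ≡ orbit b → a ≡ b
        orbit-injective {a} {b} a<j b<j same with <-cmp a b
        ... | tri< a<b _ _ = contradiction same (distinct a<b b<j)
        ... | tri≈ _ a≡b _ = a≡b
        ... | tri> _ _ b<a = contradiction (sym same) (distinct b<a a<j)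

        vs-injective : ∀ t u → vs t ≡ vs u → t ≡ u
        vs-injective t u same =
          toℕ-injective (+-cancelʳ-≡ _ _ _ (orbit-injective (t+i<j t) (t+i<j u) same))

        vs-cnext : ∀ t → vs (cnext t) ≡ f (vs t)
        vs-cnext t with cnext-toℕ t
        ... | inj₁ next≡1+t         = cong (λ a → orbit (a + i)) next≡1+t
        ... | inj₂ (t≡len , next≡0) = begin
          vs (cnext t)          ≡⟨ cong vs next≡0 ⟩
          orbit i               ≡⟨ closes ⟩
          orbit j               ≡⟨ cong orbit (sym len+1+i≡j) ⟩
          orbit (len + suc i)   ≡⟨ cong orbit (+-suc len i) ⟩
          orbit (suc (len + i)) ≡⟨ cong (λ a → orbit (suc (a + i))) (sym t≡len) ⟩
          f (vs t)              ∎
          where open ≡-Reasoning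

    Repeats : Pred ℕ 0ℓ
    Repeats j = ∃[ i ] (i < j × orbit i ≡ orbit j)

    repeats? : Decidable Repeats
    repeats? j = anyUpTo? (λ i → orbit i ≟ orbit j) j

    some-repeat : ∃ Repeats
    some-repeat with pigeonhole (n<1+n N) (orbit ∘ toℕ)
    ... | i , j , i<j , same = toℕ j , toℕ i , i<j , same

  -- The cycle is the segment of the orbit of z from the first repeated point to its repetition.
  invariant⇒cycle : Cycle f P
  invariant⇒cycle with least repeats? _ (proj₂ some-repeat)
  ... | j , (i , i<j , closes) , first =
    segment-cycle i<j closes (λ a<b b<j same → <⇒≱ b<j (first (_ , a<b , same)))

module _ {N m} (vs : Fin (suc m) → Fin N) (dir : Fin (suc m) → Bool) {i : Fin (suc m)} where

  stepSrc-forward : dir i ≡ true → stepSrc vs dir i ≡ vs i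
  stepSrc-forward d rewrite d = refl

  stepTgt-forward : dir i ≡ true → stepTgt vs dir i ≡ vs (cnext i)
  stepTgt-forward d rewrite d = refl

  stepSrc-backward : dir i ≡ false → stepSrc vs dir i ≡ vs (cnext i)
  stepSrc-backward d rewrite d = refl

  stepTgt-backward : dir i ≡ false → stepTgt vs dir i ≡ vs i
  stepTgt-backward d rewrite d = refl

weight : Bool → ℕ → ℕ
weight true  p = p + p
weight false p = suc (p + p)

weight-< : ∀ {p q} a b → p < q → weight a p < weight b q
weight-< true  true  p<q = +-mono-< p<q p<q
weight-< true  false p<q = m≤n⇒m≤1+n (+-mono-< p<q p<q)
weight-< false true  p<q = ≤-trans (s≤s (≤-reflexive (sym (+-suc _ _)))) (+-mono-≤ p<q p<q)
weight-< false false p<q = s≤s (+-mono-< p<q p<q)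

weight-red<blue : ∀ p → weight true p < weight false p
weight-red<blue p = n<1+n (p + p)

module _ {G : Digraph} {col : Coloring G} (Ψ : Fin (n G) → ℕ)
         (red-increasing : ∀ {u w} → Red G col u w → Ψ u < Ψ w)
         (blue-below-red-sibling : ∀ {u w x} → Red G col u w → Edge G u x → col u x ≡ false →
                                   Ψ x < Ψ w)
         where

  module _ (c : DependencyCycle G col) where
    open DependencyCycle c

    color : Fin (suc (suc k)) → Bool
    color i = col (src i) (tgt i)

    θ : Fin (suc (suc k)) → ℕ
    θ i = weight (color i) (Ψ (tgt i))

    module Ascending (δ≡true : δ ≡ true) where
      red-src : ∀ {i} → color i ≡ true → src i ≡ vs i
      red-src r = stepSrc-forward vs dir (trans (red-dir _ r) δ≡true)

      red-tgt : ∀ {i} → color i ≡ true → tgt i ≡ vs (cnext i)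
      red-tgt r = stepTgt-forward vs dir (trans (red-dir _ r) δ≡true)

      blue-src : ∀ {i} → color i ≡ false → src i ≡ vs (cnext i)
      blue-src b = stepSrc-backward vs dir (trans (¬-not (blue-dir _ b)) (cong not δ≡true))

      blue-tgt : ∀ {i} → color i ≡ false → tgt i ≡ vs i
      blue-tgt b = stepTgt-backward vs dir (trans (¬-not (blue-dir _ b)) (cong not δ≡true))

      ascending : ∀ i → weight (color i) (Ψ (tgt i)) < weight (color (cnext i)) (Ψ (tgt (cnext i)))
      ascending i with color i in ci | color (cnext i) in cj
      ... | true  | true  =
            weight-< true true (subst (λ v → Ψ v < Ψ (tgt j)) src-j≡tgt-i (red-increasing (isEdge j , cj)))
        where
          j = cnext i
          src-j≡tgt-i = trans (red-src cj) (sym (red-tgt ci))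
      ... | true  | false =
            subst (λ v → weight true (Ψ (tgt i)) < weight false (Ψ v)) tgt-i≡tgt-j
                  (weight-red<blue (Ψ (tgt i)))
        where
          tgt-i≡tgt-j = trans (red-tgt ci) (sym (blue-tgt cj))
      ... | false | true  =
            weight-< false true (blue-below-red-sibling (isEdge j , cj)
                                   (subst (λ v → Edge G v (tgt i)) src-i≡src-j (isEdge i))
                                   (subst (λ v → col v (tgt i) ≡ false) src-i≡src-j ci))
        where
          j = cnext i
          src-i≡src-j = trans (blue-src ci) (sym (red-src cj))
      ... | false | false = contradiction (ci , cj) (no-two-blue i)

    module Descending (δ≡false : δ ≡ false) where
      red-src : ∀ {i} → color i ≡ true → src i ≡ vs (cnext i)
      red-src r = stepSrc-backward vs dir (trans (red-dir _ r) δ≡false)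

      red-tgt : ∀ {i} → color i ≡ true → tgt i ≡ vs i
      red-tgt r = stepTgt-backward vs dir (trans (red-dir _ r) δ≡false)

      blue-src : ∀ {i} → color i ≡ false → src i ≡ vs i
      blue-src b = stepSrc-forward vs dir (trans (¬-not (blue-dir _ b)) (cong not δ≡false))

      blue-tgt : ∀ {i} → color i ≡ false → tgt i ≡ vs (cnext i)
      blue-tgt b = stepTgt-forward vs dir (trans (¬-not (blue-dir _ b)) (cong not δ≡false))

      descending : ∀ i → weight (color (cnext i)) (Ψ (tgt (cnext i))) < weight (color i) (Ψ (tgt i))
      descending i with color i in ci | color (cnext i) in cj
      ... | true  | true  =
            weight-< true true (subst (λ v → Ψ v < Ψ (tgt i)) src-i≡tgt-j (red-increasing (isEdge i , ci)))
        where
          src-i≡tgt-j = trans (red-src ci) (sym (red-tgt cj))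
      ... | true  | false =
            weight-< false true (blue-below-red-sibling (isEdge i , ci)
                                   (subst (λ v → Edge G v (tgt j)) src-j≡src-i (isEdge j))
                                   (subst (λ v → col v (tgt j) ≡ false) src-j≡src-i cj))
        where
          j = cnext i
          src-j≡src-i = trans (blue-src cj) (sym (red-src ci))
      ... | false | true  =
            subst (λ v → weight true (Ψ v) < weight false (Ψ (tgt i))) tgt-i≡tgt-j
                  (weight-red<blue (Ψ (tgt i)))
        where
          tgt-i≡tgt-j = trans (blue-tgt ci) (sym (red-tgt cj))
      ... | false | false = contradiction (ci , cj) (no-two-blue i)

  potential⇒no-dependency-cycle : ¬ DependencyCycle G col
  potential⇒no-dependency-cycle c with DependencyCycle.δ c in δ≡
  ... | true  = no-ascending-cycle (θ c) (Ascending.ascending c δ≡)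
  ... | false = no-descending-cycle (θ c) (Descending.descending c δ≡)

module Propagation (G : Digraph) (S : Subset (n G)) where

  edge? : ∀ u v → Dec (Edge G u v)
  edge? u v = adj G u v Bool.≟ true

  Dominates : Fin (n G) → Fin (n G) → Set
  Dominates u w = u ∈ S × Edge G u w

  dominates? : ∀ u w → Dec (Dominates u w)
  dominates? u w = (u ∈? S) ×-dec edge? u w

  ObservedByD1 : Pred (Fin (n G)) 0ℓ
  ObservedByD1 w = w ∈ S ⊎ ∃[ u ] Dominates u w

  observedByD1? : Decidable ObservedByD1
  observedByD1? w = (w ∈? S) ⊎-dec any? (λ u → dominates? u w)

  -- P_S restricted to derivations with at most k nested applications of (D2).
  data InPWithin : ℕ → Pred (Fin (n G)) 0ℓ where
    d1 : ∀ {k w} → ObservedByD1 w → InPWithin k w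
    d2 : ∀ {k v w} → InPWithin k v → Edge G v w →
         (∀ u → Edge G v u → u ≢ w → InPWithin k u) → InPWithin (suc k) w

  Forces : ℕ → Fin (n G) → Fin (n G) → Set
  Forces k v w = InPWithin k v × Edge G v w × (∀ u → Edge G v u → u ≢ w → InPWithin k u)

  mutual
    InPWithin? : ∀ k → Decidable (InPWithin k)
    InPWithin? zero    w = map′ d1 (λ { (d1 o) → o }) (observedByD1? w)
    InPWithin? (suc k) w =
      map′ [ d1 , (λ (_ , p , e , others) → d2 p e others) ]
           (λ { (d1 o) → inj₁ o ; (d2 p e others) → inj₂ (_ , p , e , others) })
           (observedByD1? w ⊎-dec any? (λ v → forces? k v w))

    forces? : ∀ k v w → Dec (Forces k v w)
    forces? k v w = InPWithin? k v ×-dec edge? v w ×-dec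
                    all? (λ u → edge? v u →-dec (¬? (u ≟ w) →-dec InPWithin? k u))

  InPWithin-grows : ∀ {k} → InPWithin k ⊆ InPWithin (suc k)
  InPWithin-grows (d1 o)          = d1 o
  InPWithin-grows (d2 p e others) =
    d2 (InPWithin-grows p) e (λ u e′ u≢w → InPWithin-grows (others u e′ u≢w))

  InPWithin-settles : ∀ {k} → InPWithin (suc k) ⊆ InPWithin k →
                      InPWithin (suc (suc k)) ⊆ InPWithin (suc k)
  InPWithin-settles settled (d1 o)          = d1 o
  InPWithin-settles settled (d2 p e others) = d2 (settled p) e (λ u e′ u≢w → settled (others u e′ u≢w))

  InPWithin-sound : ∀ {k} → InPWithin k ⊆ InP G S
  InPWithin-sound (d1 (inj₁ w∈S))           = d1-self w∈S
  InPWithin-sound (d1 (inj₂ (_ , u∈S , e))) = d1-nbr u∈S e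
  InPWithin-sound (d2 p e others)           =
    d2 (InPWithin-sound p) e (λ u e′ u≢w → InPWithin-sound (others u e′ u≢w))

  InP⇒InPWithin : InP G S ⊆ InPWithin (n G)
  InP⇒InPWithin (d1-self w∈S)   = d1 (inj₁ w∈S)
  InP⇒InPWithin (d1-nbr u∈S e)  = d1 (inj₂ (_ , u∈S , e))
  InP⇒InPWithin (d2 p e others) =
    chain-stabilises InPWithin InPWithin? InPWithin-grows InPWithin-settles
      (d2 (InP⇒InPWithin p) e (λ u e′ u≢w → InP⇒InPWithin (others u e′ u≢w)))

  InP? : Decidable (InP G S)
  InP? w = map′ InPWithin-sound InP⇒InPWithin (InPWithin? (n G) w)

module FromPowerDomination (G : Digraph) (S : Subset (n G)) (pd : PowerDominates G S) where
  open Propagation G S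

  first-round : ∀ w → Least (λ k → InPWithin k w)
  first-round w = least (λ k → InPWithin? k w) (n G) (InP⇒InPWithin (pd w))

  time : Fin (n G) → ℕ
  time w = proj₁ (first-round w)

  time-least : ∀ {k w} → InPWithin k w → time w ≤ k
  time-least {w = w} = proj₂ (proj₂ (first-round w))

  record ForcedBy (w v : Fin (n G)) : Set where
    field
      edge             : Edge G v w
      forcer-earlier   : time v < time w
      siblings-earlier : ∀ u → Edge G v u → u ≢ w → time u < time w

  forced : ∀ w → ¬ ObservedByD1 w → ∃ (ForcedBy w)
  forced w = forced-at (proj₁ (proj₂ (first-round w))) refl
    where
      forced-at : ∀ {k} → InPWithin k w → time w ≡ k → ¬ ObservedByD1 w → ∃ (ForcedBy w)
      forced-at (d1 o) _ late = contradiction o late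
      forced-at {suc r} (d2 p e others) time≡ _ = _ , record
        { edge             = e
        ; forcer-earlier   = earlier p
        ; siblings-earlier = λ u e′ u≢w → earlier (others u e′ u≢w)
        }
        where
          earlier : ∀ {u} → InPWithin r u → time u < time w
          earlier {u} q = subst (time u <_) (sym time≡) (s≤s (time-least q))

  -- Why w ∉ S entered P_S; the red edge into w comes from the vertex named here.
  data Parent (w : Fin (n G)) : Fin (n G) → Set where
    dominator : ∀ {u} → w ∉ S → Dominates u w → (∀ {u′} → Dominates u′ w → u Fin.≤ u′) →
                Parent w u
    forcer    : ∀ {v} → ¬ ObservedByD1 w → ForcedBy w v → Parent w v

  parent-edge : ∀ {w u} → Parent w u → Edge G u w
  parent-edge (dominator _ (_ , e) _) = e
  parent-edge (forcer _ fb)           = ForcedBy.edge fb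

  parent-∉ : ∀ {w u} → Parent w u → w ∉ S
  parent-∉ (dominator w∉S _ _) = w∉S
  parent-∉ (forcer late _)     = late ∘ inj₁

  reason : ∀ w → w ∈ S ⊎ ∃ (Parent w)
  reason w with w ∈? S
  ... | yes w∈S = inj₁ w∈S
  ... | no w∉S with any? (λ u → dominates? u w)
  ...   | yes dominated =
          let u , dom , first = least-Fin (λ u → dominates? u w) dominated
          in inj₂ (u , dominator w∉S dom first)
  ...   | no undominated =
          let late = [ w∉S , undominated ] in inj₂ (Σ.map₂ (forcer late) (forced w late))

  coloring : Coloring G
  coloring u w with reason w
  ... | inj₁ _       = false
  ... | inj₂ (v , _) = does (v ≟ u)

  rank : ∀ {w u} → Parent w u → ℕ
  rank {u = u} (dominator _ _ _) = suc (toℕ u)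
  rank {w}     (forcer _ _)      = n G + time w

  Ψ : Fin (n G) → ℕ
  Ψ w with reason w
  ... | inj₁ _       = 0
  ... | inj₂ (_ , p) = rank p

  red⇒parent : ∀ {u w} → coloring u w ≡ true → Σ (Parent w u) λ p → Ψ w ≡ rank p
  red⇒parent {u} {w} c with reason w
  red⇒parent () | inj₁ _
  ... | inj₂ (v , p) with v ≟ u
  ...   | yes refl = p , refl
  red⇒parent () | inj₂ _ | no _

  Ψ-∈ : ∀ {u} → u ∈ S → Ψ u ≡ 0
  Ψ-∈ {u} u∈S with reason u
  ... | inj₁ _       = refl
  ... | inj₂ (_ , p) = contradiction u∈S (parent-∉ p)

  Ψ≤n+time : ∀ u → Ψ u ≤ n G + time u
  Ψ≤n+time u with reason u
  ... | inj₁ _                     = z≤n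
  ... | inj₂ (v , dominator _ _ _) = ≤-trans (toℕ<n v) (m≤m+n (n G) (time u))
  ... | inj₂ (_ , forcer _ _)      = ≤-refl

  earlier⇒Ψ< : ∀ {u w} → time u < time w → Ψ u < n G + time w
  earlier⇒Ψ< {u} u<w = ≤-<-trans (Ψ≤n+time u) (+-monoʳ-< (n G) u<w)

  Ψ-parent< : ∀ {w u} (p : Parent w u) → Ψ u < rank p
  Ψ-parent< (dominator _ (u∈S , _) _) rewrite Ψ-∈ u∈S = s≤s z≤n
  Ψ-parent< (forcer _ fb)                             = earlier⇒Ψ< (ForcedBy.forcer-earlier fb)

  red-increasing : ∀ {u w} → Red G coloring u w → Ψ u < Ψ w
  red-increasing {u} {w} (_ , c) with red⇒parent {u} {w} c
  ... | p , Ψw≡ = subst (Ψ u <_) (sym Ψw≡) (Ψ-parent< p)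

  -- The parent of x ∈ N(S) ∖ S is its dominator of least index, so it precedes any other one.
  blue-dominated< : ∀ {u x} → Dominates u x → coloring u x ≡ false → Ψ x < suc (toℕ u)
  blue-dominated< {u} {x} dom c with reason x
  ... | inj₁ _                         = s≤s z≤n
  ... | inj₂ (v , dominator _ _ first) =
        s≤s (≤∧≢⇒< (first dom) (does-false⇒¬ (v ≟ u) c ∘ toℕ-injective))
  ... | inj₂ (_ , forcer late _)       = contradiction (inj₂ (u , dom)) late

  blue-below-red-sibling : ∀ {u w x} → Red G coloring u w → Edge G u x → coloring u x ≡ false →
                           Ψ x < Ψ w
  blue-below-red-sibling {u} {w} {x} (_ , c) e c′ with red⇒parent {u} {w} c
  ... | dominator _ (u∈S , _) _ , Ψw≡ = subst (Ψ x <_) (sym Ψw≡) (blue-dominated< (u∈S , e) c′)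
  ... | forcer _ fb , Ψw≡             =
        subst (Ψ x <_) (sym Ψw≡) (earlier⇒Ψ< (ForcedBy.siblings-earlier fb x e x≢w))
    where
      x≢w : x ≢ w
      x≢w refl = contradiction (trans (sym c) c′) λ ()

  red-in-unique : ∀ {u u′ w} → coloring u w ≡ true → coloring u′ w ≡ true → u ≡ u′
  red-in-unique {u} {u′} {w} c c′ with reason w
  red-in-unique () _ | inj₁ _
  ... | inj₂ (v , _) with v ≟ u | v ≟ u′
  ...   | yes refl | yes refl = refl
  red-in-unique () _ | inj₂ _ | no _  | _
  red-in-unique _ () | inj₂ _ | yes _ | no _

  red-from-non-origin : ∀ {v w} → v ∉ S → coloring v w ≡ true → ForcedBy w v
  red-from-non-origin {v} {w} v∉S c with red⇒parent {v} {w} c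
  ... | dominator _ (v∈S , _) _ , _ = contradiction v∈S v∉S
  ... | forcer _ fb , _             = fb

  red-out-unique : ∀ u v w w′ → Red G coloring u v → Red G coloring v w → Red G coloring v w′ →
                   w ≡ w′
  red-out-unique u v w w′ (_ , c) (e , c₁) (e′ , c₂) with w ≟ w′
  ... | yes w≡w′ = w≡w′
  ... | no w≢w′  = contradiction (ForcedBy.siblings-earlier fb w′ e′ (w≢w′ ∘ sym))
                                 (<⇒≯ (ForcedBy.siblings-earlier fb′ w e w≢w′))
    where
      v∉S = parent-∉ (proj₁ (red⇒parent {u} {v} c))
      fb  = red-from-non-origin {v} {w} v∉S c₁
      fb′ = red-from-non-origin {v} {w′} v∉S c₂

  red-parent : ∀ {w} → w ∉ S → ∃[ u ] Red G coloring u w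
  red-parent {w} w∉S with reason w
  ... | inj₁ w∈S     = contradiction w∈S w∉S
  ... | inj₂ (u , p) = u , parent-edge p , dec-true (u ≟ u) refl

  valid : Valid G coloring
  valid = record
    { noRedAntiparallel = λ u v (r , r′) → <-asym (red-increasing {u} {v} r) (red-increasing {v} {u} r′)
    ; inDeg≤1           = λ u u′ v (_ , c) (_ , c′) → red-in-unique {u} {u′} {v} c c′
    ; outDeg≤1          = red-out-unique
    ; noDepCycle        = potential⇒no-dependency-cycle Ψ red-increasing blue-below-red-sibling
    }

  origins : ∀ v → (v ∈ S) ⇔ Origin G coloring v
  origins v = mk⇔ (λ v∈S (u , _ , c) → parent-∉ (proj₁ (red⇒parent {u} {v} c)) v∈S)
                  (λ origin → decidable-stable (v ∈? S) (origin ∘ red-parent {v}))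

module FromColoring (G : Digraph) (S : Subset (n G)) (col : Coloring G) (val : Valid G col)
                    (origins : ∀ v → (v ∈ S) ⇔ Origin G col v) where
  open Propagation G S
  open Valid val

  red? : ∀ u v → Dec (Red G col u v)
  red? u v = edge? u v ×-dec (col u v Bool.≟ true)

  red-parent : ∀ {v} → v ∉ S → ∃[ u ] Red G col u v
  red-parent {v} v∉S = decidable-stable (any? (λ u → red? u v)) (v∉S ∘ Equivalence.from (origins v))

  Stalled : Pred (Fin (n G)) 0ℓ
  Stalled v = InP G S v × ∃[ w ] (Red G col v w × ¬ InP G S w)

  OnWalk : Pred (Fin (n G)) 0ℓ
  OnWalk v = ¬ InP G S v ⊎ Stalled v

  Next : Fin (n G) → Fin (n G) → Set
  Next v x = (InP G S v × Edge G v x × col v x ≡ false × ¬ InP G S x) ⊎ (¬ InP G S v × Red G col x v)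

  next? : ∀ v x → Dec (Next v x)
  next? v x = (InP? v ×-dec edge? v x ×-dec (col v x Bool.≟ false) ×-dec ¬? (InP? x))
              ⊎-dec (¬? (InP? v) ×-dec red? x v)

  -- Red out-degree at most one makes every other out-neighbour blue, and (D2) failing puts
  -- one of them outside P_S.
  stalled-escape : ∀ {v} → Stalled v → ∃[ x ] (Edge G v x × col v x ≡ false × ¬ InP G S x)
  stalled-escape {v} (v∈P , w , (e , c) , w∉P) =
    let x , e′ , x≢w , x∉P = decidable-stable (any? λ x → edge? v x ×-dec ¬? (x ≟ w) ×-dec ¬? (InP? x))
                                              escape
    in x , e′ , ¬-not (λ c′ → x≢w (sym (red-out w x (e , c) (e′ , c′)))) , x∉P
    where
      v∉S : v ∉ S
      v∉S v∈S = w∉P (d1-nbr v∈S e)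

      red-out : ∀ w x → Red G col v w → Red G col v x → w ≡ x
      red-out w x = let u , r = red-parent v∉S in outDeg≤1 u v w x r

      escape : ¬ ¬ (∃[ x ] (Edge G v x × x ≢ w × ¬ InP G S x))
      escape none = w∉P (d2 v∈P e λ x e′ x≢w →
        decidable-stable (InP? x) (λ x∉P → none (x , e′ , x≢w , x∉P)))

  next-exists : ∀ {v} → OnWalk v → ∃ (Next v)
  next-exists (inj₁ v∉P)     = Σ.map₂ (λ r → inj₂ (v∉P , r)) (red-parent (v∉P ∘ d1-self))
  next-exists (inj₂ stalled) =
    Σ.map₂ (λ (e , c , x∉P) → inj₁ (proj₁ stalled , e , c , x∉P)) (stalled-escape stalled)

  next-on-walk : ∀ {v x} → Next v x → OnWalk x
  next-on-walk (inj₁ (_ , _ , _ , x∉P)) = inj₁ x∉P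
  next-on-walk {v} {x} (inj₂ (v∉P , r)) with InP? x
  ... | yes x∈P = inj₂ (x∈P , v , r , v∉P)
  ... | no x∉P  = inj₁ x∉P

  next-≢ : ∀ {v x} → Next v x → x ≢ v
  next-≢ {v} (inj₁ (_ , e , _)) refl = contradiction (trans (sym e) (noLoop G v)) λ ()
  next-≢ {v} (inj₂ (_ , e , _)) refl = contradiction (trans (sym e) (noLoop G v)) λ ()

  walk : Fin (n G) → Fin (n G)
  walk v = choose (next? v) v

  walk-next : ∀ {v} → OnWalk v → Next v (walk v)
  walk-next {v} on = choose-∈ (next? v) v (next-exists on)

  module _ {k} (vs : Fin (suc (suc k)) → Fin (n G)) (vs-injective : ∀ i j → vs i ≡ vs j → i ≡ j)
           (vs-cnext : ∀ i → vs (cnext i) ≡ walk (vs i)) (vs-on : ∀ i → OnWalk (vs i)) where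

    -- Steps out of vertices of P_S are traversed forwards (blue), the others backwards (red).
    dir : Fin (suc (suc k)) → Bool
    dir i = does (InP? (vs i))

    src tgt : Fin (suc (suc k)) → Fin (n G)
    src = stepSrc vs dir
    tgt = stepTgt vs dir

    link : ∀ i → Next (vs i) (vs (cnext i))
    link i = subst (Next (vs i)) (sym (vs-cnext i)) (walk-next (vs-on i))

    forward-step : ∀ {i} → InP G S (vs i) → src i ≡ vs i × tgt i ≡ vs (cnext i)
    forward-step p = let d = dec-true (InP? _) p in stepSrc-forward vs dir d , stepTgt-forward vs dir d

    backward-step : ∀ {i} → ¬ InP G S (vs i) → src i ≡ vs (cnext i) × tgt i ≡ vs i
    backward-step ¬p = let d = dec-false (InP? _) ¬p in stepSrc-backward vs dir d , stepTgt-backward vs dir d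

    step-edge : ∀ i → Edge G (src i) (tgt i)
    step-edge i with link i
    ... | inj₁ (p , e , _)  = let s≡ , t≡ = forward-step p in subst₂ (Edge G) (sym s≡) (sym t≡) e
    ... | inj₂ (¬p , e , _) = let s≡ , t≡ = backward-step ¬p in subst₂ (Edge G) (sym s≡) (sym t≡) e

    step-color : ∀ i → col (src i) (tgt i) ≡ not (dir i)
    step-color i with link i
    ... | inj₁ (p , _ , c , _) =
          let s≡ , t≡ = forward-step p
          in trans (cong₂ col s≡ t≡) (trans c (cong not (sym (dec-true (InP? _) p))))
    ... | inj₂ (¬p , _ , c) =
          let s≡ , t≡ = backward-step ¬p
          in trans (cong₂ col s≡ t≡) (trans c (cong not (sym (dec-false (InP? _) ¬p))))

    same-step : ∀ i j → dir i ≡ dir j → src i ≡ src j → tgt i ≡ tgt j → i ≡ j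
    same-step i j same s≡ t≡ = by-dir (dir i) refl
      where
        by-dir : ∀ b → dir i ≡ b → i ≡ j
        by-dir true  d = vs-injective i j (trans (sym (stepSrc-forward vs dir d))
                                                 (trans s≡ (stepSrc-forward vs dir (trans (sym same) d))))
        by-dir false d = vs-injective i j (trans (sym (stepTgt-backward vs dir d))
                                                 (trans t≡ (stepTgt-backward vs dir (trans (sym same) d))))

    blue⇒in-P : ∀ {i} → col (src i) (tgt i) ≡ false → InP G S (vs i)
    blue⇒in-P {i} b = does-true⇒ (InP? _) (not-injective (trans (sym (step-color i)) b))

    no-two-blue : ∀ i → ¬ (col (src i) (tgt i) ≡ false × col (src (cnext i)) (tgt (cnext i)) ≡ false)
    no-two-blue i (b , b′) with link i
    ... | inj₁ (_ , _ , _ , next∉P) = next∉P (blue⇒in-P b′)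
    ... | inj₂ (v∉P , _)           = v∉P (blue⇒in-P b)

    dependency-cycle : DependencyCycle G col
    dependency-cycle = record
      { k              = k
      ; vs             = vs
      ; dir            = dir
      ; vs-injective   = vs-injective
      ; isEdge         = step-edge
      ; edges-distinct = λ i j i≢j (s≡ , t≡) →
          i≢j (same-step i j (not-injective (trans (sym (step-color i))
                                                     (trans (cong₂ col s≡ t≡) (step-color j))))
                         s≡ t≡)
      ; δ              = false
      ; red-dir        = λ i r → not-injective (trans (sym (step-color i)) r)
      ; blue-dir       = λ i b d → contradiction (trans (sym b) (trans (step-color i) (cong not d))) λ ()
      ; no-two-blue    = no-two-blue
      }

  no-walk-cycle : ¬ Cycle walk OnWalk
  no-walk-cycle record { len = zero ; vs = vs ; vs-cnext = vs-cnext ; vs-∈ = vs-on } =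
    next-≢ (walk-next (vs-on zero)) (sym (vs-cnext zero))
  no-walk-cycle record { len = suc _ ; vs = vs ; vs-injective = vs-injective ; vs-cnext = vs-cnext
                       ; vs-∈ = vs-on } =
    noDepCycle (dependency-cycle vs vs-injective vs-cnext vs-on)

  power-dominates : PowerDominates G S
  power-dominates v = decidable-stable (InP? v) λ v∉P →
    no-walk-cycle (invariant⇒cycle walk (next-on-walk ∘ walk-next) (inj₁ v∉P))

lemma9 : (G : Digraph) (S : Subset (n G)) →
         PowerDominates G S ⇔ ValidColoringWithOrigins G S
lemma9 G S = mk⇔ (λ pd → let open FromPowerDomination G S pd in coloring , valid , origins)
                 (λ (col , valid , origins) → FromColoring.power-dominates G S col valid origins)
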